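{- Let $\lambda$ be a strict partition with $|\lambda|=n$ and let $T\in{\rm ShSYT}'(\lambda)$. Then $\mathrm{Des}(T^\circ)=[n-1]\setminus\mathrm{Des}(T)$.
   Context: For a strict partition $\lambda=(\lambda_1>\cdots>\lambda_k>0)$ its shifted diagram is $D^{sh}_\lambda=\{(i,j):i\le j\le\lambda_i+i-1\}$; cells $(i,i)$ are diagonal. ${\rm ShSYT}'(\lambda)$ is the set of marked shifted standard Young tableaux of shape $\lambda$: bijective fillings of $D^{sh}_\lambda$ by $1,\ldots,|\lambda|$ increasing along rows and down columns, where each off-diagonal entry may additionally be marked (written $i'$), diagonal entries being unmarked. For such $T$, $T^\circ$ is obtained by marking every unmarked off-diagonal entry and unmarking every marked entry. $\mathrm{Des}(T)$ is the set of $i\in[n-1]$ such that either (a) $i$ is unmarked and $i+1$ is marked; or (b) $i$ and $i+1$ are both unmarked and the row of $i$ is strictly smaller than the row of $i+1$; or (c) $i$ and $i+1$ are both marked and the column of $i$ is strictly smaller than the column of $i+1$. -}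

module Defs where

open import Data.Nat using (ℕ; zero; suc; _+_; _≤_; _<_; _>_)
open import Data.Bool using (Bool; true; false; not; if_then_else_)
open import Data.List using (List; []; _∷_)
open import Data.Nat.ListAction using (sum)
open import Data.List.Relation.Unary.All using (All)
open import Data.List.Relation.Unary.Linked using (Linked)
open import Data.Product using (_×_; _,_; Σ; proj₁; proj₂)
open import Data.Sum using (_⊎_)
open import Relation.Binary.PropositionalEquality using (_≡_; _≢_)
open import Relation.Nullary using (¬_)
open import Relation.Nullary.Decidable using (⌊_⌋)
open import Data.Nat using (_≟_)

StrictPartition : List ℕ → Set
StrictPartition la = All (λ x → 0 < x) la × Linked _>_ la

size : List ℕ → ℕ
size = sum

-- λ_i for 1-indexed row i (0 for rows outside 1..k)
part : List ℕ → ℕ → ℕ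
part []      _             = 0
part (x ∷ _) (suc zero)    = x
part (_ ∷ l) (suc (suc i)) = part l (suc i)
part (_ ∷ _) zero          = 0

-- cell (i , j) lies in the shifted diagram: 1 ≤ i ≤ j ≤ λ_i + i - 1
-- (the bound j ≤ λ_i + i - 1 is written j < λ_i + i; it forces λ_i > 0, i.e. i ≤ k)
InShifted : List ℕ → ℕ × ℕ → Set
InShifted la (i , j) = 1 ≤ i × i ≤ j × j < part la i + i

row col : ℕ × ℕ → ℕ
row = proj₁
col = proj₂

diagonal : ℕ × ℕ → Bool
diagonal (i , j) = ⌊ i ≟ j ⌋

-- A marked shifted standard Young tableau of shape λ (n = |λ|), described by
-- its inverse filling: pos v is the cell containing entry v (v ∈ [1,n]) and
-- marked v records whether v is marked (v').
record ShSYT' (la : List ℕ) : Set where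
  field
    pos    : ℕ → ℕ × ℕ
    marked : ℕ → Bool
    pos-in   : ∀ v → 1 ≤ v → v ≤ size la → InShifted la (pos v)
    pos-inj  : ∀ u v → 1 ≤ u → u ≤ size la → 1 ≤ v → v ≤ size la →
               pos u ≡ pos v → u ≡ v
    pos-surj : ∀ c → InShifted la c → Σ ℕ λ v → 1 ≤ v × v ≤ size la × pos v ≡ c
    row-incr : ∀ u v → 1 ≤ u → u ≤ size la → 1 ≤ v → v ≤ size la →
               row (pos u) ≡ row (pos v) → col (pos u) < col (pos v) → u < v
    col-incr : ∀ u v → 1 ≤ u → u ≤ size la → 1 ≤ v → v ≤ size la →
               col (pos u) ≡ col (pos v) → row (pos u) < row (pos v) → u < v
    diag-unmarked : ∀ v → 1 ≤ v → v ≤ size la → diagonal (pos v) ≡ true →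
                    marked v ≡ false
open ShSYT' public

_° : ∀ {la} → ShSYT' la → ShSYT' la
T ° = record
  { pos = pos T
  ; marked = λ v → if diagonal (pos T v) then false else not (marked T v)
  ; pos-in = pos-in T
  ; pos-inj = pos-inj T
  ; pos-surj = pos-surj T
  ; row-incr = row-incr T
  ; col-incr = col-incr T
  ; diag-unmarked = λ v _ _ d → helper (diagonal (pos T v)) d
  }
  where
  helper : ∀ b {m} → b ≡ true → (if b then false else m) ≡ false
  helper true _ = Relation.Binary.PropositionalEquality.refl

Des : ∀ {la} → ShSYT' la → ℕ → Set
Des {la} T i =
  1 ≤ i × i < size la ×
  ( (marked T i ≡ false × marked T (suc i) ≡ true)
  ⊎ (marked T i ≡ false × marked T (suc i) ≡ false × row (pos T i) < row (pos T (suc i)))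
  ⊎ (marked T i ≡ true  × marked T (suc i) ≡ true  × col (pos T i) < col (pos T (suc i))) )

{-# OPTIONS --safe #-}

-- For consecutive entries i and i+1 of a shifted standard tableau exactly one of
-- "i+1 lies in a lower row" and "i+1 lies in a column further right" holds: if both
-- held, the cell in the row of i and the column of i+1 would belong to the shifted
-- diagram (for a strict partition the rows end in weakly decreasing columns) and its
-- entry would lie strictly between i and i+1. So whether i is a descent is a Boolean
-- function of the two marks and this one bit, and toggling both marks negates it.
-- A diagonal entry keeps its mark, but it also forces the bit (a diagonal i has i+1
-- weakly above it, a diagonal i+1 lies below i), and for those values toggling the
-- other mark alone already negates it.
module Submission where

open import Defs
open import Data.Nat using (ℕ; _≤_; _<_)
open import Data.List using (List)
open import Data.Product using (_×_)
open import Relation.Nullary using (¬_)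
open import Function.Bundles using (_⇔_)

open import Data.Nat using (zero; suc; _+_; _>_; z≤n; s≤s; _≤?_; _<?_; _≟_)
open import Data.Nat.Properties
open import Data.Bool using (Bool; true; false; not; if_then_else_)
open import Data.Bool.Properties using (not-involutive; T-≡)
open import Data.List using (_∷_)
open import Data.List.Relation.Unary.Linked using (Linked; _∷_)
open import Data.Product using (_,_; proj₁; proj₂; ∃)
open import Data.Sum using (_⊎_; inj₁; inj₂)
open import Data.Empty using (⊥-elim)
open import Relation.Nullary using (Dec; yes; no; does)
open import Relation.Nullary.Decidable using (dec-true; dec-false; toWitness)
open import Relation.Binary.PropositionalEquality using (_≡_; refl; sym; trans; cong; cong₂; subst)
open import Function.Bundles using (mk⇔; Equivalence)
open import Function using (_∘_)
open import Function.Properties.Equivalence using () renaming (sym to ⇔-sym; trans to ⇔-trans)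
open import Function.Related.TypeIsomorphisms using (¬-cong-⇔)

part-suc-< : ∀ {la} → Linked _>_ la → ∀ r → 1 ≤ r → 0 < part la (suc r) →
             part la (suc r) < part la r
part-suc-< {x ∷ y ∷ _} (x>y ∷ _)  (suc zero)    _ _   = x>y
part-suc-< {x ∷ y ∷ _} (_   ∷ lk) (suc (suc r)) _ pos = part-suc-< lk (suc r) (s≤s z≤n) pos

part+index-antitone : ∀ {la} → Linked _>_ la → ∀ {r r'} → 1 ≤ r → r ≤ r' →
                      0 < part la r' → part la r' + r' ≤ part la r + r
part+index-antitone lk {r' = zero} (s≤s _) ()
part+index-antitone {la} lk {r} {suc r'} 1≤r r≤1+r' pos with r ≤? r'
... | no r≰r' rewrite ≤-antisym r≤1+r' (≰⇒> r≰r') = ≤-refl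
... | yes r≤r' = ≤-trans shift (part+index-antitone lk 1≤r r≤r' (<-trans pos next<))
  where
  next< : part la (suc r') < part la r'
  next< = part-suc-< lk r' (≤-trans 1≤r r≤r') pos
  shift : part la (suc r') + suc r' ≤ part la r' + r'
  shift = subst (_≤ part la r' + r') (sym (+-suc (part la (suc r')) r')) (+-monoˡ-≤ r' next<)

InShifted⇒part-pos : ∀ {la r c} → InShifted la (r , c) → 0 < part la r
InShifted⇒part-pos {la} {r} (_ , r≤c , c<end) with part la r
... | zero  = ⊥-elim (<⇒≱ c<end r≤c)
... | suc _ = s≤s z≤n

InShifted-corner : ∀ {la} → Linked _>_ la → ∀ {r c r' c'} →
                   InShifted la (r , c) → InShifted la (r' , c') → r ≤ r' → c ≤ c' →
                   InShifted la (r , c')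
InShifted-corner {la} lk (1≤r , r≤c , _) cell'@(_ , _ , c'<end') r≤r' c≤c' =
  1≤r , ≤-trans r≤c c≤c' ,
  <-≤-trans c'<end' (part+index-antitone lk 1≤r r≤r' (InShifted⇒part-pos {la} cell'))

DescentCases : Bool → Bool → Set → Set → Set
DescentCases a b R C = (a ≡ false × b ≡ true)
                     ⊎ (a ≡ false × b ≡ false × R)
                     ⊎ (a ≡ true × b ≡ true × C)

descentᵇ : Bool → Bool → Bool → Bool
descentᵇ false true  _ = true
descentᵇ false false r = r
descentᵇ true  true  r = not r
descentᵇ true  false _ = false

DescentCases⇔descentᵇ : ∀ {R C} (R? : Dec R) → (R → ¬ C) → (¬ R → C) →
                        ∀ a b → DescentCases a b R C ⇔ descentᵇ a b (does R?) ≡ true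
DescentCases⇔descentᵇ {R} {C} R? R⇒¬C ¬R⇒C a b = mk⇔ to (from a b R?)
  where
  to : DescentCases a b R C → descentᵇ a b (does R?) ≡ true
  to (inj₁ (refl , refl))             = refl
  to (inj₂ (inj₁ (refl , refl , r))) = dec-true R? r
  to (inj₂ (inj₂ (refl , refl , c))) = cong not (dec-false R? (λ r → R⇒¬C r c))
  from : ∀ a b (R? : Dec R) → descentᵇ a b (does R?) ≡ true → DescentCases a b R C
  from false true  _        _ = inj₁ (refl , refl)
  from false false (yes r)  _ = inj₂ (inj₁ (refl , refl , r))
  from false false (no _)   ()
  from true  true  (yes _)  ()
  from true  true  (no ¬r)  _ = inj₂ (inj₂ (refl , refl , ¬R⇒C ¬r))
  from true  false _        ()

descentᵇ-not-not : ∀ a b r → descentᵇ (not a) (not b) r ≡ not (descentᵇ a b r)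
descentᵇ-not-not false false r = refl
descentᵇ-not-not false true  r = refl
descentᵇ-not-not true  false r = refl
descentᵇ-not-not true  true  r = sym (not-involutive r)

descentᵇ-false-not : ∀ b → descentᵇ false (not b) false ≡ not (descentᵇ false b false)
descentᵇ-false-not false = refl
descentᵇ-false-not true  = refl

descentᵇ-not-false : ∀ a → descentᵇ (not a) false true ≡ not (descentᵇ a false true)
descentᵇ-not-false false = refl
descentᵇ-not-false true  = refl

descentᵇ-° : ∀ {di dj mi mj r} →
             (di ≡ true → mi ≡ false) → (dj ≡ true → mj ≡ false) →
             (di ≡ true → r ≡ false) → (dj ≡ true → r ≡ true) →
             descentᵇ (if di then false else not mi) (if dj then false else not mj) r
               ≡ not (descentᵇ mi mj r)
descentᵇ-° {false} {false} {mi} {mj} {r} _ _ _ _ = descentᵇ-not-not mi mj r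
descentᵇ-° {true}  {false} {mi} {mj} mi≡ _ r≡ _ rewrite mi≡ refl | r≡ refl = descentᵇ-false-not mj
descentᵇ-° {false} {true}  {mi} {mj} _ mj≡ _ r≡ rewrite mj≡ refl | r≡ refl = descentᵇ-not-false mi
descentᵇ-° {true}  {true}  _ _ r≡false r≡true with trans (sym (r≡false refl)) (r≡true refl)
... | ()

≡not⇒≡true⇔≢true : ∀ {x y} → x ≡ not y → x ≡ true ⇔ (¬ y ≡ true)
≡not⇒≡true⇔≢true {y = true}  refl = mk⇔ (λ ()) (λ y≢true → ⊥-elim (y≢true refl))
≡not⇒≡true⇔≢true {y = false} refl = mk⇔ (λ _ ()) (λ _ → refl)

diagonal⇒row≡col : ∀ {c} → diagonal c ≡ true → row c ≡ col c
diagonal⇒row≡col {i , j} d = toWitness {a? = i ≟ j} (Equivalence.from T-≡ d)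

NextBelow NextRight : ∀ {la} → ShSYT' la → ℕ → Set
NextBelow T i = row (pos T i) < row (pos T (suc i))
NextRight T i = col (pos T i) < col (pos T (suc i))

module _ {la} (lk : Linked _>_ la) (T : ShSYT' la) where

  northwest-entry-between : ∀ {u v} → 1 ≤ u → u ≤ size la → 1 ≤ v → v ≤ size la →
                            row (pos T u) < row (pos T v) → col (pos T u) < col (pos T v) →
                            ∃ λ w → u < w × w < v
  northwest-entry-between {u} {v} 1≤u u≤n 1≤v v≤n r< c<
    with pos-surj T (row (pos T u) , col (pos T v))
           (InShifted-corner lk (pos-in T u 1≤u u≤n) (pos-in T v 1≤v v≤n) (<⇒≤ r<) (<⇒≤ c<))
  ... | w , 1≤w , w≤n , pos-w≡ =
    w , row-incr T u w 1≤u u≤n 1≤w w≤n (sym (cong row pos-w≡))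
          (subst (col (pos T u) <_) (sym (cong col pos-w≡)) c<)
      , col-incr T w v 1≤w w≤n 1≤v v≤n (cong col pos-w≡)
          (subst (_< row (pos T v)) (sym (cong row pos-w≡)) r<)

  weakly-northwest⇒≤ : ∀ {u v} → 1 ≤ u → u ≤ size la → 1 ≤ v → v ≤ size la →
                       row (pos T u) ≤ row (pos T v) → col (pos T u) ≤ col (pos T v) → u ≤ v
  weakly-northwest⇒≤ 1≤u u≤n 1≤v v≤n r≤ c≤ with m≤n⇒m<n∨m≡n r≤ | m≤n⇒m<n∨m≡n c≤
  ... | inj₁ r< | inj₁ c< with northwest-entry-between 1≤u u≤n 1≤v v≤n r< c<
  ...   | _ , u<w , w<v = <⇒≤ (<-trans u<w w<v)
  weakly-northwest⇒≤ 1≤u u≤n 1≤v v≤n _ _ | inj₁ r< | inj₂ c≡ =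
    <⇒≤ (col-incr T _ _ 1≤u u≤n 1≤v v≤n c≡ r<)
  weakly-northwest⇒≤ 1≤u u≤n 1≤v v≤n _ _ | inj₂ r≡ | inj₁ c< =
    <⇒≤ (row-incr T _ _ 1≤u u≤n 1≤v v≤n r≡ c<)
  weakly-northwest⇒≤ 1≤u u≤n 1≤v v≤n _ _ | inj₂ r≡ | inj₂ c≡ =
    ≤-reflexive (pos-inj T _ _ 1≤u u≤n 1≤v v≤n (cong₂ _,_ r≡ c≡))

  module _ {i} (1≤i : 1 ≤ i) (i<n : i < size la) where

    private
      i≤n : i ≤ size la
      i≤n = <⇒≤ i<n
      1≤1+i : 1 ≤ suc i
      1≤1+i = s≤s z≤n

    below⇒¬right : NextBelow T i → ¬ NextRight T i
    below⇒¬right r< c< with northwest-entry-between 1≤i i≤n 1≤1+i i<n r< c<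
    ... | _ , i<w , w<1+i = <⇒≱ i<w (≤-pred w<1+i)

    ¬below⇒right : ¬ NextBelow T i → NextRight T i
    ¬below⇒right ¬r< = ≰⇒> λ c'≤c →
      1+n≰n (weakly-northwest⇒≤ 1≤1+i i<n 1≤i i≤n (≮⇒≥ ¬r<) c'≤c)

    diagonal⇒¬below : diagonal (pos T i) ≡ true → ¬ NextBelow T i
    diagonal⇒¬below d r< = below⇒¬right r<
      (subst (_< col (pos T (suc i))) (diagonal⇒row≡col d)
        (<-≤-trans r< (proj₁ (proj₂ (pos-in T (suc i) 1≤1+i i<n)))))

    next-diagonal⇒below : diagonal (pos T (suc i)) ≡ true → NextBelow T i
    next-diagonal⇒below d with row (pos T i) <? row (pos T (suc i))
    ... | yes r< = r<
    ... | no ¬r< = ⊥-elim (<⇒≱ (¬below⇒right ¬r<)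
          (≤-trans (≤-reflexive (sym (diagonal⇒row≡col d)))
            (≤-trans (≮⇒≥ ¬r<) (proj₁ (proj₂ (pos-in T i 1≤i i≤n))))))

    °-descent⇔¬descent :
      DescentCases (marked (T °) i) (marked (T °) (suc i)) (NextBelow T i) (NextRight T i)
      ⇔ (¬ DescentCases (marked T i) (marked T (suc i)) (NextBelow T i) (NextRight T i))
    °-descent⇔¬descent =
      ⇔-trans reflect (⇔-trans (≡not⇒≡true⇔≢true flipped) (¬-cong-⇔ (⇔-sym reflect)))
      where
      below? : Dec (NextBelow T i)
      below? = row (pos T i) <? row (pos T (suc i))
      reflect : ∀ {a b} → DescentCases a b (NextBelow T i) (NextRight T i)
                          ⇔ descentᵇ a b (does below?) ≡ true
      reflect {a} {b} = DescentCases⇔descentᵇ below? below⇒¬right ¬below⇒right a b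
      flipped : descentᵇ (marked (T °) i) (marked (T °) (suc i)) (does below?)
                ≡ not (descentᵇ (marked T i) (marked T (suc i)) (does below?))
      flipped = descentᵇ-° (diag-unmarked T i 1≤i i≤n) (diag-unmarked T (suc i) 1≤1+i i<n)
                  (dec-false below? ∘ diagonal⇒¬below) (dec-true below? ∘ next-diagonal⇒below)

lemma2p1 : (la : List ℕ) → StrictPartition la → (T : ShSYT' la) →
           ∀ i → Des (T °) i ⇔ (1 ≤ i × i < size la × ¬ Des T i)
lemma2p1 la (_ , lk) T i = mk⇔
  (λ (1≤i , i<n , d°) → 1≤i , i<n , λ (_ , _ , d) →
     Equivalence.to (°-descent⇔¬descent lk T 1≤i i<n) d° d)
  (λ (1≤i , i<n , ¬d) → 1≤i , i<n ,
     Equivalence.from (°-descent⇔¬descent lk T 1≤i i<n) (λ d → ¬d (1≤i , i<n , d)))
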